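{- If $M$ is an $\omega$-complete effect monoid, then the Boolean algebra of idempotents $P(M)$ is $\omega$-complete.
   Context: An effect algebra is a set $E$ with an element $0$, a partial binary operation $a+b$ (the partial sum), and a total complement $a\mapsto a^\perp$, such that: the sum is commutative and associative wherever defined, $a+0=a$, $a^\perp$ is the unique element with $a+a^\perp=1$ where $1:=0^\perp$, and $a+1$ defined implies $a=0$. The order is $a\le b$ iff $b=a+c$ for some $c$. An effect monoid is an effect algebra with an associative total multiplication $\cdot$ with unit $1$ which distributes over the partial sum on both sides. It is $\omega$-complete if every increasing sequence has a supremum. $P(M)$ is the set of $p\in M$ with $p\cdot p=p$; with the order inherited from $M$ it is a Boolean algebra. -}

module Defs where

open import Data.Nat using (ℕ; suc)
open import Data.Maybe using (Maybe; just)
open import Data.Product using (Σ; ∃; _×_; _,_)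
open import Relation.Binary.PropositionalEquality using (_≡_)

-- An effect algebra: carrier E, element 0, partial sum (as Maybe-valued
-- function; `nothing` = undefined), total complement.
record EffectAlgebra : Set₁ where
  field
    Carrier : Set
    𝟘       : Carrier
    _⊕_     : Carrier → Carrier → Maybe Carrier
    _ᗮ      : Carrier → Carrier

  𝟙 : Carrier
  𝟙 = 𝟘 ᗮ

  field
    ⊕-comm  : ∀ a b → a ⊕ b ≡ b ⊕ a
    ⊕-assoc : ∀ a b c ab abc → a ⊕ b ≡ just ab → ab ⊕ c ≡ just abc →
              Σ Carrier λ bc → (b ⊕ c ≡ just bc) × (a ⊕ bc ≡ just abc)
    ⊕-zero  : ∀ a → a ⊕ 𝟘 ≡ just a
    ᗮ-sum   : ∀ a → a ⊕ (a ᗮ) ≡ just 𝟙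
    ᗮ-uniq  : ∀ a b → a ⊕ b ≡ just 𝟙 → b ≡ a ᗮ
    zero-one : ∀ a x → a ⊕ 𝟙 ≡ just x → a ≡ 𝟘

  _≤_ : Carrier → Carrier → Set
  a ≤ b = Σ Carrier λ c → a ⊕ c ≡ just b

record EffectMonoid : Set₁ where
  field
    EA : EffectAlgebra
  open EffectAlgebra EA public
  field
    _·_     : Carrier → Carrier → Carrier
    ·-assoc : ∀ a b c → (a · b) · c ≡ a · (b · c)
    ·-idˡ   : ∀ a → 𝟙 · a ≡ a
    ·-idʳ   : ∀ a → a · 𝟙 ≡ a
    ·-distribˡ : ∀ a b c d → b ⊕ c ≡ just d → (a · b) ⊕ (a · c) ≡ just (a · d)
    ·-distribʳ : ∀ a b c d → b ⊕ c ≡ just d → (b · a) ⊕ (c · a) ≡ just (d · a)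

  IsIdempotent : Carrier → Set
  IsIdempotent p = p · p ≡ p

module _ (E : EffectAlgebra) where
  open EffectAlgebra E

  Increasing : (ℕ → Carrier) → Set
  Increasing a = ∀ n → a n ≤ a (suc n)

  IsSupremum : (ℕ → Carrier) → Carrier → Set
  IsSupremum a s = (∀ n → a n ≤ s) × (∀ u → (∀ n → a n ≤ u) → s ≤ u)

IsωComplete : EffectAlgebra → Set
IsωComplete E = ∀ (a : ℕ → Carrier) → Increasing E a → Σ Carrier (IsSupremum E a)
  where open EffectAlgebra E

PωComplete : EffectMonoid → Set
PωComplete M =
  ∀ (p : ℕ → Carrier) → (∀ n → IsIdempotent (p n)) → Increasing EA p →
  Σ Carrier λ s → IsIdempotent s × (∀ n → p n ≤ s)
    × (∀ u → IsIdempotent u → (∀ n → p n ≤ u) → s ≤ u)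
  where open EffectMonoid M

IsωCompleteEM : EffectMonoid → Set
IsωCompleteEM M = IsωComplete (EffectMonoid.EA M)

module Submission where

-- Let p₀ ≤ p₁ ≤ … be idempotents of an ω-complete
-- effect monoid M and let s be their supremum in M.  It suffices to show
-- that s is itself idempotent: then s is an upper bound in P(M), and it is
-- below every upper bound in M, in particular below every idempotent one.
-- Idempotency of s follows by antisymmetry from two inequalities:
--   * s · s ≤ s, since any product a · b lies below its left factor a;
--   * s ≤ s · s, since every pₙ = pₙ · pₙ ≤ pₙ · s ≤ s · s by monotonicity
--     of multiplication, so s · s is an upper bound of the sequence.

open import Defs
open import Data.Nat using (ℕ)
open import Data.Maybe using (just)
open import Data.Maybe.Properties using (just-injective)
open import Data.Product using (Σ; _×_; _,_)
open import Relation.Binary.PropositionalEquality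

module EffectAlgebraOrder (E : EffectAlgebra) where
  open EffectAlgebra E

  ᗮ-sumˡ : ∀ a → (a ᗮ) ⊕ a ≡ just 𝟙
  ᗮ-sumˡ a = trans (⊕-comm (a ᗮ) a) (ᗮ-sum a)

  -- In a ⊕ x = d the summand x is determined by a and d: it is the
  -- complement of dᗮ ⊕ a.  This is the source of cancellation.
  summand-determined : ∀ a x d → a ⊕ x ≡ just d →
                       Σ Carrier λ w → ((d ᗮ) ⊕ a ≡ just w) × (x ≡ w ᗮ)
  summand-determined a x d ax≡d
    with ⊕-assoc a x (d ᗮ) d 𝟙 ax≡d (ᗮ-sum d)
  ... | xd , x⊕dᗮ≡xd , a⊕xd≡𝟙
    with ᗮ-uniq a xd a⊕xd≡𝟙
  ... | refl
    with ⊕-assoc x (d ᗮ) a (a ᗮ) 𝟙 x⊕dᗮ≡xd (ᗮ-sumˡ a)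
  ... | w , dᗮ⊕a≡w , x⊕w≡𝟙 = w , dᗮ⊕a≡w , ᗮ-uniq w x (trans (⊕-comm w x) x⊕w≡𝟙)

  ⊕-cancelˡ : ∀ a b c d → a ⊕ b ≡ just d → a ⊕ c ≡ just d → b ≡ c
  ⊕-cancelˡ a b c d ab≡d ac≡d
    with summand-determined a b d ab≡d | summand-determined a c d ac≡d
  ... | w₁ , e₁ , b≡w₁ᗮ | w₂ , e₂ , c≡w₂ᗮ = begin
    b       ≡⟨ b≡w₁ᗮ ⟩
    w₁ ᗮ    ≡⟨ cong _ᗮ (just-injective (trans (sym e₁) e₂)) ⟩
    w₂ ᗮ    ≡⟨ sym c≡w₂ᗮ ⟩
    c       ∎
    where open ≡-Reasoning

  𝟘⊕𝟙≡𝟙 : 𝟘 ⊕ 𝟙 ≡ just 𝟙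
  𝟘⊕𝟙≡𝟙 = trans (⊕-comm 𝟘 𝟙) (⊕-zero 𝟙)

  -- Positivity: if c ⊕ d = 0 then c = 0 (otherwise c ⊕ 1 would be defined).
  ⊕-positive : ∀ c d → c ⊕ d ≡ just 𝟘 → c ≡ 𝟘
  ⊕-positive c d cd≡𝟘
    with ⊕-assoc d c 𝟙 𝟘 𝟙 (trans (⊕-comm d c) cd≡𝟘) 𝟘⊕𝟙≡𝟙
  ... | c1 , c⊕𝟙≡c1 , _ = zero-one c c1 c⊕𝟙≡c1

  -- The algebraic order is antisymmetric: from b = a ⊕ c and a = b ⊕ d we
  -- get a ⊕ (c ⊕ d) = a ⊕ 0, so c ⊕ d = 0, hence c = 0 and b = a.
  ≤-antisym : ∀ a b → a ≤ b → b ≤ a → a ≡ b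
  ≤-antisym a b (c , a⊕c≡b) (d , b⊕d≡a)
    with ⊕-assoc a c d b a a⊕c≡b b⊕d≡a
  ... | cd , c⊕d≡cd , a⊕cd≡a
    with ⊕-cancelˡ a cd 𝟘 a a⊕cd≡a (⊕-zero a)
  ... | refl
    with ⊕-positive c d c⊕d≡cd
  ... | refl = just-injective (trans (sym (⊕-zero a)) a⊕c≡b)

  ≤-trans : ∀ a b e → a ≤ b → b ≤ e → a ≤ e
  ≤-trans a b e (c , a⊕c≡b) (d , b⊕d≡e)
    with ⊕-assoc a c d b e a⊕c≡b b⊕d≡e
  ... | cd , _ , a⊕cd≡e = cd , a⊕cd≡e

module EffectMonoidOrder (M : EffectMonoid) where
  open EffectMonoid M
  open EffectAlgebraOrder EA

  ·-monoʳ-≤ : ∀ c a b → a ≤ b → (c · a) ≤ (c · b)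
  ·-monoʳ-≤ c a b (d , a⊕d≡b) = c · d , ·-distribˡ c a d b a⊕d≡b

  ·-monoˡ-≤ : ∀ c a b → a ≤ b → (a · c) ≤ (b · c)
  ·-monoˡ-≤ c a b (d , a⊕d≡b) = d · c , ·-distribʳ c a d b a⊕d≡b

  -- A product lies below its left factor: a · b ⊕ a · bᗮ = a · 1 = a.
  ·-≤-left : ∀ a b → (a · b) ≤ a
  ·-≤-left a b =
    a · (b ᗮ) ,
    subst (λ z → (a · b) ⊕ (a · (b ᗮ)) ≡ just z) (·-idʳ a)
          (·-distribˡ a b (b ᗮ) 𝟙 (ᗮ-sum b))

  -- Key lemma: a supremum in M of any sequence of idempotents is idempotent.
  -- s · s ≤ s holds for every element; conversely each pₙ = pₙ · pₙ is below
  -- pₙ · s ≤ s · s, so s · s is an upper bound and hence above s.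
  supremum-idempotent : ∀ (p : ℕ → Carrier) s → (∀ n → IsIdempotent (p n)) →
                        IsSupremum EA p s → IsIdempotent s
  supremum-idempotent p s idem (upper , least) =
    ≤-antisym (s · s) s (·-≤-left s s) (least (s · s) pₙ≤s·s)
    where
    pₙ≤s·s : ∀ n → p n ≤ (s · s)
    pₙ≤s·s n = ≤-trans (p n) (p n · s) (s · s)
      (subst (λ z → z ≤ (p n · s)) (idem n) (·-monoʳ-≤ (p n) (p n) s (upper n)))
      (·-monoˡ-≤ s (p n) s (upper n))

proposition46 : (M : EffectMonoid) → IsωCompleteEM M → PωComplete M
proposition46 M complete p idem increasing
  with complete p increasing
... | s , sup@(upper , least) =
  s , supremum-idempotent p s idem sup , upper , λ u _ p≤u → least u p≤u
  where open EffectMonoidOrder M
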